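{- For every positive integer $k$ there is a finite set of permutations $B_k$ such that a permutation $\pi$ is sortable by $k$ pop stacks in parallel with a bypass if and only if $\pi\in\mathrm{Av}(B_k)$.
   Context: $\mathrm{Av}(T)$ is the set of permutations avoiding every pattern in $T$. The device "$k$ pop stacks in parallel with a bypass" processes the entries of the input $\pi=\pi_1\cdots\pi_n$ from left to right; at each step one may push the current input entry on top of any one of the $k$ pop stacks, pop any pop stack (removing all its elements and appending them to the output from top to bottom), or bypass (append the current input entry directly to the output). At the end all pop stacks are emptied into the output. $\pi$ is sortable if some sequence of such operations produces the output $12\cdots n$. -}

module Defs where

open import Data.Nat using (ℕ; zero; suc; _<_)
open import Data.Fin using (Fin; toℕ)
open import Data.Fin.Base using () renaming (_<_ to _<ᶠ_)
open import Data.List using (List; []; _∷_; _++_; tabulate; upTo)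
open import Data.List.Membership.Propositional using (_∈_)
open import Data.Vec using (Vec; lookup; _[_]≔_; replicate)
open import Data.Product using (Σ; ∃; _×_; _,_)
open import Function.Definitions using (Injective)
open import Function.Bundles using (_⇔_)
open import Relation.Binary.PropositionalEquality using (_≡_)
open import Relation.Binary.Construct.Closure.ReflexiveTransitive using (Star)
open import Relation.Nullary using (¬_)

-- A permutation of length n: an injective (hence bijective) map
-- Fin n → Fin n, read as the word π(0) π(1) ... π(n-1) with values 0..n-1.
record Perm (n : ℕ) : Set where
  constructor perm
  field
    fun : Fin n → Fin n
    inj : Injective _≡_ _≡_ fun
open Perm public

AnyPerm : Set
AnyPerm = Σ ℕ Perm

Contains : {n m : ℕ} → Perm n → Perm m → Set
Contains {n} {m} π σ =
  Σ (Fin m → Fin n) λ f →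
    (∀ i j → i <ᶠ j → f i <ᶠ f j) ×
    (∀ i j → (fun σ i <ᶠ fun σ j) ⇔ (fun π (f i) <ᶠ fun π (f j)))

Av : List AnyPerm → {n : ℕ} → Perm n → Set
Av T π = ∀ {m} (σ : Perm m) → (m , σ) ∈ T → ¬ Contains π σ

-- Device: k pop stacks in parallel with a bypass.
-- A stack is a list whose head is the top element.
record Config (k : ℕ) : Set where
  constructor config
  field
    input  : List ℕ
    stacks : Vec (List ℕ) k
    output : List ℕ

data Step (k : ℕ) : Config k → Config k → Set where
  push   : ∀ {x inp sts out} (s : Fin k) →
           Step k (config (x ∷ inp) sts out)
                  (config inp (sts [ s ]≔ (x ∷ lookup sts s)) out)
  pop    : ∀ {inp sts out} (s : Fin k) →
           Step k (config inp sts out)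
                  (config inp (sts [ s ]≔ []) (out ++ lookup sts s))
  bypass : ∀ {x inp sts out} →
           Step k (config (x ∷ inp) sts out) (config inp sts (out ++ (x ∷ [])))

word : {n : ℕ} → Perm n → List ℕ
word π = tabulate (λ i → toℕ (fun π i))

Sortable : (k : ℕ) → {n : ℕ} → Perm n → Set
Sortable k {n} π =
  Star (Step k) (config (word π) (replicate k []) [])
                (config [] (replicate k []) (upTo n))

-- Call two entries conflicting if they can never lie in a common pop stack: popping it must
-- output consecutive values in increasing order. An obstruction is a set of k + 1 pairwise
-- conflicting entries all preceding a smaller entry, the pivot. When the pivot is read none of
-- them can have been output, so they would need k + 1 distinct stacks; hence a sortable
-- permutation has no obstruction. Conversely, the greedy strategy (bypass the next needed
-- value, push x onto the stack topped by x + 1, else onto an empty stack, and pop every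
-- stack whose top is needed next) can only get stuck when the entry just read, together with
-- the k stack tops and the position of the next needed value, forms an obstruction.
-- An obstruction only involves its pivot, its blockers and at most two witnesses for each
-- conflicting pair, so it already occurs in a pattern of length at most (k + 1)(2k + 3) + 1,
-- and B_k is the finite list of obstructed permutations of at most that length.

module Submission where

open import Defs
open import Data.Nat using (ℕ; zero; suc; pred; >-nonZero; _+_; _*_; _≤_; _<_; z≤n; s≤s; s≤s⁻¹)
  renaming (_≟_ to _≟ℕ_; _<?_ to _<?ℕ_)
open import Data.Nat.Properties hiding (_≟_; _<?_)
open import Data.Fin using (Fin; zero; suc; toℕ; fromℕ<; punchIn; punchOut)
open import Data.Fin.Base using () renaming (_<_ to _<ᶠ_)
open import Data.Fin.Properties
  using ( toℕ-injective; toℕ<n; toℕ≤n; toℕ-fromℕ<; pigeonhole; injective⇒≤; ¬∀⟶∃¬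
        ; any?; all?; _<?_; punchOut-injective; punchIn-injective
        ; punchInᵢ≢i; punchIn-mono-≤; punchOut-mono-≤; punchIn-punchOut; punchOut-cong )
  renaming (_≟_ to _≟ᶠ_; <⇒≢ to <⇒≢ᶠ)
open import Data.List
  using (List; []; _∷_; _++_; length; applyUpTo; upTo; tabulate; drop; concatMap; allFin; map)
open import Data.List.Properties
  using (∷-injective; ≡-dec; drop-[]; upTo-∷ʳ; ++-assoc; ++-identityʳ; length-++; length-tabulate)
open import Data.List.Membership.Propositional using (_∈_; lose)
open import Data.List.Membership.Propositional.Properties
  using (∈-++⁺ˡ; ∈-++⁺ʳ; ∈-++⁻; ∈-concatMap⁺; ∈-concatMap⁻; ∈-map⁺; ∈-allFin; ∈-tabulate⁺; ∈-upTo⁺)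
open import Data.List.Relation.Unary.Any using (here; there; satisfied)
  renaming (index to indexOf; any? to anyᴸ?)
open import Data.List.Relation.Unary.Any.Properties using (lookup-index)
open import Data.List.Relation.Unary.All using () renaming (tabulate to tabulateᴬ; lookup to lookupᴬ)
open import Data.List.Relation.Unary.AllPairs using (AllPairs; []; _∷_)
open import Data.Vec using (Vec; []; _∷_; lookup; _[_]≔_; replicate)
  renaming (tabulate to tabulateⱽ; map to mapⱽ)
open import Data.Vec.Properties using (lookup∘update; lookup∘update′; lookup-replicate; lookup∘tabulate; lookup-map)
open import Data.Product using (Σ; ∃; ∃₂; _×_; _,_; proj₁; proj₂)
open import Data.Sum using (_⊎_; inj₁; inj₂)
open import Data.Empty using (⊥; ⊥-elim)
open import Function using (id; _∘_)
open import Function.Bundles using (_⇔_; mk⇔; Equivalence)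
open import Function.Construct.Composition using (_⇔-∘_)
open import Function.Definitions using (Injective)
open import Relation.Binary using (tri<; tri≈; tri>)
open import Relation.Binary.PropositionalEquality
open import Relation.Binary.Construct.Closure.ReflexiveTransitive using (Star; ε; _◅_; _◅◅_)
open import Relation.Nullary using (¬_; Dec; yes; no)
open import Relation.Nullary.Decidable using (_×-dec_; _⊎-dec_; _→-dec_; ¬?; map′)

open Equivalence using (to; from)

range : ℕ → ℕ → List ℕ
range a zero    = []
range a (suc m) = a ∷ range (suc a) m

length-range : ∀ a m → length (range a m) ≡ m
length-range a zero    = refl
length-range a (suc m) = cong suc (length-range (suc a) m)

applyUpTo-range : ∀ (f : ℕ → ℕ) a m → (∀ x → f x ≡ a + x) → applyUpTo f m ≡ range a m
applyUpTo-range f a zero    f≗a+ = refl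
applyUpTo-range f a (suc m) f≗a+ =
  cong₂ _∷_ (trans (f≗a+ 0) (+-identityʳ a))
            (applyUpTo-range (f ∘ suc) (suc a) m (λ x → trans (f≗a+ (suc x)) (+-suc a x)))

upTo-range : ∀ n → upTo n ≡ range 0 n
upTo-range n = applyUpTo-range id 0 n (λ _ → refl)

range-++ : ∀ a m m′ → range a (m + m′) ≡ range a m ++ range (a + m) m′
range-++ a zero    m′ = cong (λ b → range b m′) (sym (+-identityʳ a))
range-++ a (suc m) m′ = cong (a ∷_) (trans (range-++ (suc a) m m′)
                                           (cong (λ b → range (suc a) m ++ range b m′) (sym (+-suc a m))))

upTo-++-range : ∀ c m → upTo c ++ range c m ≡ upTo (c + m)
upTo-++-range c m = begin
  upTo c ++ range c m       ≡⟨ cong (_++ range c m) (upTo-range c) ⟩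
  range 0 c ++ range c m    ≡⟨ range-++ 0 c m ⟨
  range 0 (c + m)           ≡⟨ upTo-range (c + m) ⟨
  upTo (c + m)              ∎
  where open ≡-Reasoning

∈-range⁻ : ∀ {v} a m → v ∈ range a m → a ≤ v × v < a + m
∈-range⁻ a (suc m) (here refl) = ≤-refl , subst (a <_) (sym (+-suc a m)) (s≤s (m≤m+n a m))
∈-range⁻ {v} a (suc m) (there v∈) with a<v , v<a+m ← ∈-range⁻ (suc a) m v∈ =
  <⇒≤ a<v , subst (v <_) (sym (+-suc a m)) v<a+m

∈-range⁺ : ∀ {v} a m → a ≤ v → v < a + m → v ∈ range a m
∈-range⁺ {v} a zero    a≤v v<a = ⊥-elim (<⇒≱ (subst (v <_) (+-identityʳ a) v<a) a≤v)
∈-range⁺ {v} a (suc m) a≤v v<a+m with a ≟ℕ v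
... | yes refl = here refl
... | no a≢v   = there (∈-range⁺ (suc a) m (≤∧≢⇒< a≤v a≢v) (subst (v <_) (+-suc a m) v<a+m))

∈-range⇒nonempty : ∀ {v} a m → v ∈ range a m → ∃ λ m′ → m ≡ suc m′
∈-range⇒nonempty a (suc m) _ = m , refl

∈-range-convex : ∀ {x y z} a m → x ∈ range a m → y ∈ range a m → x < z → z < y → z ∈ range a m
∈-range-convex a m x∈ y∈ x<z z<y =
  ∈-range⁺ a m (≤-trans (proj₁ (∈-range⁻ a m x∈)) (<⇒≤ x<z)) (<-trans z<y (proj₂ (∈-range⁻ a m y∈)))

∈-range-pred : ∀ {v} a m → v ∈ range a m → a ≡ v ⊎ ∃ λ v′ → v ≡ suc v′ × v′ ∈ range a m
∈-range-pred {zero}  a m v∈ = inj₁ (n≤0⇒n≡0 (proj₁ (∈-range⁻ a m v∈)))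
∈-range-pred {suc v} a m v∈ with a ≟ℕ suc v
... | yes a≡v = inj₁ a≡v
... | no a≢v  = inj₂ (v , refl , ∈-range⁺ a m (s≤s⁻¹ (≤∧≢⇒< a≤v a≢v)) (<-trans ≤-refl v<a+m))
  where
  a≤v = proj₁ (∈-range⁻ a m v∈)
  v<a+m = proj₂ (∈-range⁻ a m v∈)

∷-range : ∀ x {L} m → L ≡ range (suc x) m → x ∷ L ≡ range x (length (x ∷ L))
∷-range x m refl = cong (λ l → x ∷ range (suc x) l) (sym (length-range (suc x) m))

range-prefix : ∀ b m L suf → range b m ≡ L ++ suf → L ≡ range b (length L)
range-prefix b m       []      suf eq = refl
range-prefix b zero    (x ∷ L) suf ()
range-prefix b (suc m) (x ∷ L) suf eq with refl , eq′ ← ∷-injective eq =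
  cong (x ∷_) (range-prefix (suc b) m L suf eq′)

range-infix : ∀ b m pre L suf → range b m ≡ pre ++ L ++ suf → ∃ λ a → L ≡ range a (length L)
range-infix b m       []        L suf eq = b , range-prefix b m L suf eq
range-infix b zero    (x ∷ pre) L suf ()
range-infix b (suc m) (x ∷ pre) L suf eq = range-infix (suc b) m pre L suf (proj₂ (∷-injective eq))

AllPairs-range : ∀ {R : ℕ → ℕ → Set} a m → AllPairs R (range a m) →
                 ∀ {x y} → x ∈ range a m → y ∈ range a m → x < y → R x y
AllPairs-range a (suc m) (a≺ ∷ rest) (here refl) y∈ x<y with y∈
... | here refl = ⊥-elim (<-irrefl refl x<y)
... | there y∈′ = lookupᴬ a≺ y∈′
AllPairs-range a (suc m) (a≺ ∷ rest) (there x∈) (here refl) x<y =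
  ⊥-elim (<⇒≱ x<y (<⇒≤ (proj₁ (∈-range⁻ (suc a) m x∈))))
AllPairs-range a (suc m) (a≺ ∷ rest) (there x∈) (there y∈) x<y = AllPairs-range (suc a) m rest x∈ y∈ x<y

drop-tabulate : ∀ {A : Set} {n} (f : Fin n → A) (j : Fin n) →
                drop (toℕ j) (tabulate f) ≡ f j ∷ drop (suc (toℕ j)) (tabulate f)
drop-tabulate f zero    = refl
drop-tabulate f (suc j) = drop-tabulate (f ∘ suc) j

drop-tabulate-∷⁻ : ∀ {A : Set} {n} (f : Fin n → A) i {x xs} → drop i (tabulate f) ≡ x ∷ xs →
                   ∃ λ p → toℕ p ≡ i × f p ≡ x × drop (suc i) (tabulate f) ≡ xs
drop-tabulate-∷⁻ {n = zero}  f i       {x} eq with () ← trans (sym eq) (drop-[] i)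
drop-tabulate-∷⁻ {n = suc n} f zero    eq with fx≡x , rest ← ∷-injective eq = zero , refl , fx≡x , rest
drop-tabulate-∷⁻ {n = suc n} f (suc i) eq with p , p≡i , fp≡x , rest ← drop-tabulate-∷⁻ (f ∘ suc) i eq =
  suc p , cong suc p≡i , fp≡x , rest

drop-tabulate-length : ∀ {A : Set} {n} (f : Fin n → A) → drop n (tabulate f) ≡ []
drop-tabulate-length {n = zero}  f = refl
drop-tabulate-length {n = suc n} f = drop-tabulate-length (f ∘ suc)

drop-tabulate-≢[] : ∀ {A : Set} {n} (f : Fin n → A) i → i < n → drop i (tabulate f) ≢ []
drop-tabulate-≢[] f zero    (s≤s _)   ()
drop-tabulate-≢[] f (suc i) (s≤s i<n) eq = drop-tabulate-≢[] (f ∘ suc) i i<n eq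

≢[]⇒∷ : ∀ {A : Set} {L : List A} → L ≢ [] → ∃₂ λ t rest → L ≡ t ∷ rest
≢[]⇒∷ {L = []}     L≢[] = ⊥-elim (L≢[] refl)
≢[]⇒∷ {L = t ∷ ts} _    = t , ts , refl

∉⇒[] : ∀ {A : Set} {L : List A} → (∀ {v} → ¬ v ∈ L) → L ≡ []
∉⇒[] {L = []}    _   = refl
∉⇒[] {L = t ∷ L} ∉L = ⊥-elim (∉L (here refl))

replicate-[] : ∀ {A : Set} {k} (v : Vec (List A) k) → (∀ s → lookup v s ≡ []) → v ≡ replicate k []
replicate-[] []      all[] = refl
replicate-[] (x ∷ v) all[] = cong₂ _∷_ (all[] zero) (replicate-[] v (all[] ∘ suc))

∈-update : ∀ {A : Set} {k} (v : Vec (List A) k) s {xs} s′ {x} → x ∈ lookup (v [ s ]≔ xs) s′ →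
           (s ≡ s′ × x ∈ xs) ⊎ (s ≢ s′ × x ∈ lookup v s′)
∈-update v s {xs} s′ {x} x∈ with s ≟ᶠ s′
... | yes refl = inj₁ (refl , subst (x ∈_) (lookup∘update s v xs) x∈)
... | no s≢s′  = inj₂ (s≢s′ , subst (x ∈_) (lookup∘update′ (s≢s′ ∘ sym) v xs) x∈)

Perm-surjective : ∀ {n} (π : Perm n) y → ∃ λ x → fun π x ≡ y
Perm-surjective {suc n} π y with any? (λ x → fun π x ≟ᶠ y)
... | yes hit = hit
... | no miss = ⊥-elim (no-collision (pigeonhole ≤-refl (punchOut ∘ miss-at)))
  where
  miss-at : ∀ x → y ≢ fun π x
  miss-at x y≡πx = miss (x , sym y≡πx)
  no-collision : ¬ ∃₂ λ a b → a <ᶠ b × punchOut (miss-at a) ≡ punchOut (miss-at b)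
  no-collision (a , b , a<b , eq) = <⇒≢ᶠ a<b (inj π (punchOut-injective (miss-at a) (miss-at b) eq))

IsEmbedding : ∀ {n m} → Perm n → Perm m → (Fin m → Fin n) → Set
IsEmbedding π σ f = (∀ i j → i <ᶠ j → f i <ᶠ f j)
                  × (∀ i j → (fun σ i <ᶠ fun σ j) ⇔ (fun π (f i) <ᶠ fun π (f j)))

IsEmbedding-id : ∀ {n} (π σ : Perm n) → (∀ i → fun σ i ≡ fun π i) → IsEmbedding π σ id
IsEmbedding-id π σ σ≗π =
  (λ i j i<j → i<j) ,
  λ i j → mk⇔ (subst₂ _<ᶠ_ (σ≗π i) (σ≗π j)) (subst₂ _<ᶠ_ (sym (σ≗π i)) (sym (σ≗π j)))

IsEmbedding-∘ : ∀ {n m l} {π : Perm n} {σ : Perm m} {τ : Perm l} f g →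
                IsEmbedding π σ f → IsEmbedding σ τ g → IsEmbedding π τ (f ∘ g)
IsEmbedding-∘ f g (f-mono , f-iso) (g-mono , g-iso) =
  (λ i j i<j → f-mono _ _ (g-mono i j i<j)) ,
  λ i j → mk⇔ (to (f-iso (g i) (g j)) ∘ to (g-iso i j)) (from (g-iso i j) ∘ from (f-iso (g i) (g j)))

IsEmbedding-reflects-< : ∀ {n m} {π : Perm n} {σ : Perm m} f → IsEmbedding π σ f →
                         ∀ i j → f i <ᶠ f j → i <ᶠ j
IsEmbedding-reflects-< f (f-mono , _) i j fi<fj with <-cmp (toℕ i) (toℕ j)
... | tri< i<j _ _ = i<j
... | tri≈ _ i≡j _ = ⊥-elim (<-irrefl (cong (toℕ ∘ f) (toℕ-injective i≡j)) fi<fj)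
... | tri> _ _ j<i = ⊥-elim (<-asym fi<fj (f-mono j i j<i))

module Delete {n} (π : Perm (suc n)) (d : Fin (suc n)) where

  private
    πd≢ : ∀ i → fun π d ≢ fun π (punchIn d i)
    πd≢ i eq = punchInᵢ≢i d i (sym (inj π eq))

    shrunk : Fin n → Fin n
    shrunk i = punchOut (πd≢ i)

    shrunk-injective : Injective _≡_ _≡_ shrunk
    shrunk-injective {a} {b} eq = punchIn-injective d a b (inj π (punchOut-injective (πd≢ a) (πd≢ b) eq))

    ≤∧≢⇒<ᶠ : ∀ {n} {a b : Fin n} → toℕ a ≤ toℕ b → a ≢ b → a <ᶠ b
    ≤∧≢⇒<ᶠ a≤b a≢b = ≤∧≢⇒< a≤b (a≢b ∘ toℕ-injective)

  deleted : Perm n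
  deleted = perm shrunk shrunk-injective

  punchIn-IsEmbedding : IsEmbedding π deleted (punchIn d)
  punchIn-IsEmbedding = punchIn-mono , λ i j → mk⇔ (preserve i j) (reflect i j)
    where
    punchIn-mono : ∀ i j → i <ᶠ j → punchIn d i <ᶠ punchIn d j
    punchIn-mono i j i<j =
      ≤∧≢⇒<ᶠ (punchIn-mono-≤ d i j (<⇒≤ i<j)) (<⇒≢ᶠ i<j ∘ punchIn-injective d i j)
    preserve : ∀ i j → shrunk i <ᶠ shrunk j → fun π (punchIn d i) <ᶠ fun π (punchIn d j)
    preserve i j lt with <-cmp (toℕ (fun π (punchIn d i))) (toℕ (fun π (punchIn d j)))
    ... | tri< gt _ _ = gt
    ... | tri≈ _ eq _ = ⊥-elim (<⇒≢ᶠ lt (cong shrunk (punchIn-injective d i j (inj π (toℕ-injective eq)))))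
    ... | tri> _ _ gt = ⊥-elim (<⇒≱ lt (punchOut-mono-≤ (πd≢ j) (πd≢ i) (<⇒≤ gt)))
    reflect : ∀ i j → fun π (punchIn d i) <ᶠ fun π (punchIn d j) → shrunk i <ᶠ shrunk j
    reflect i j lt = ≤∧≢⇒<ᶠ (punchOut-mono-≤ (πd≢ i) (πd≢ j) (<⇒≤ lt))
                            (<⇒≢ᶠ lt ∘ cong (fun π ∘ punchIn d) ∘ shrunk-injective)

deleteAll : ∀ {n} (d : Fin (suc n)) → List (Fin (suc n)) → List (Fin n)
deleteAll d []       = []
deleteAll d (x ∷ xs) with d ≟ᶠ x
... | yes _  = deleteAll d xs
... | no d≢x = punchOut d≢x ∷ deleteAll d xs

length-deleteAll : ∀ {n} (d : Fin (suc n)) xs → length (deleteAll d xs) ≤ length xs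
length-deleteAll d []       = z≤n
length-deleteAll d (x ∷ xs) with d ≟ᶠ x
... | yes _ = m≤n⇒m≤1+n (length-deleteAll d xs)
... | no _  = s≤s (length-deleteAll d xs)

∈-deleteAll : ∀ {n} (d : Fin (suc n)) {xs ℓ} → ℓ ∈ xs → (d≢ℓ : d ≢ ℓ) → punchOut d≢ℓ ∈ deleteAll d xs
∈-deleteAll d {x ∷ xs} (here refl) d≢ℓ with d ≟ᶠ x
... | yes d≡ℓ = ⊥-elim (d≢ℓ d≡ℓ)
... | no _    = here (punchOut-cong d refl)
∈-deleteAll d {x ∷ xs} (there ℓ∈) d≢ℓ with d ≟ᶠ x
... | yes _ = ∈-deleteAll d ℓ∈ d≢ℓ
... | no _  = there (∈-deleteAll d ℓ∈ d≢ℓ)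

covering⇒≤length : ∀ {n} (L : List (Fin n)) → (∀ x → x ∈ L) → n ≤ length L
covering⇒≤length L covers = injective⇒≤ {f = indexOf ∘ covers} λ {x} {y} eq →
  trans (lookup-index (covers x)) (trans (cong (Data.List.lookup L) eq) (sym (lookup-index (covers y))))

_∈?_ : ∀ {n} (x : Fin n) (L : List (Fin n)) → Dec (x ∈ L)
x ∈? L = anyᴸ? (x ≟ᶠ_) L

InImage : ∀ {n m} → (Fin m → Fin n) → List (Fin n) → Set
InImage f ws = ∀ {z} → z ∈ ws → ∃ λ z̃ → f z̃ ≡ z

pattern-covering : ∀ {n} (π : Perm n) (L : List (Fin n)) →
  ∃ λ m → Σ (Perm m) λ σ → Σ (Fin m → Fin n) λ f →
    IsEmbedding π σ f × m ≤ length L × InImage f L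
pattern-covering {n} π L with all? (_∈? L)
... | yes covers = n , π , id , IsEmbedding-id π π (λ _ → refl) , covering⇒≤length L covers , λ {ℓ} _ → ℓ , refl
pattern-covering {zero} π L | no ¬covers = ⊥-elim (¬covers (λ ()))
pattern-covering {suc n} π L | no ¬covers
  with d , d∉L ← ¬∀⟶∃¬ (suc n) _ (_∈? L) ¬covers
  with m , σ , f , f-emb , m≤ , f-covers ← pattern-covering (Delete.deleted π d) (deleteAll d L) =
  m , σ , punchIn d ∘ f ,
  IsEmbedding-∘ {π = π} {Delete.deleted π d} {σ} (punchIn d) f (Delete.punchIn-IsEmbedding π d) f-emb ,
  ≤-trans m≤ (length-deleteAll d L) , covers
  where
  covers : InImage (punchIn d ∘ f) L
  covers {ℓ} ℓ∈L with d ≟ᶠ ℓ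
  ... | yes refl = ⊥-elim (d∉L ℓ∈L)
  ... | no d≢ℓ with i , fi≡ ← f-covers (∈-deleteAll d ℓ∈L d≢ℓ) =
    i , trans (cong (punchIn d) fi≡) (punchIn-punchOut d≢ℓ)

-- Conflicts and obstructions

-- Reasons why the entry at position j can never lie above the one at position i < j in a pop
-- stack: popping that stack would not output consecutive values in increasing order.
data Conflict {n} (σ : Perm n) (i j : Fin n) : Set where
  ascent       : fun σ i <ᶠ fun σ j → Conflict σ i j
  gap-before   : ∀ z → fun σ j <ᶠ fun σ z → fun σ z <ᶠ fun σ i → z <ᶠ i → Conflict σ i j
  gap-after    : ∀ z → fun σ j <ᶠ fun σ z → fun σ z <ᶠ fun σ i → j <ᶠ z → Conflict σ i j
  inner-ascent : ∀ z z′ → i <ᶠ z → z <ᶠ z′ → z′ <ᶠ j →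
                 fun σ j <ᶠ fun σ z → fun σ z <ᶠ fun σ z′ → fun σ z′ <ᶠ fun σ i → Conflict σ i j

conflict? : ∀ {n} (σ : Perm n) i j → Dec (Conflict σ i j)
conflict? σ i j = map′ fromSum toSum
  ( (fun σ i <? fun σ j)
  ⊎-dec any? (λ z → (fun σ j <? fun σ z) ×-dec (fun σ z <? fun σ i) ×-dec (z <? i))
  ⊎-dec any? (λ z → (fun σ j <? fun σ z) ×-dec (fun σ z <? fun σ i) ×-dec (j <? z))
  ⊎-dec any? (λ z → any? (λ z′ → (i <? z) ×-dec (z <? z′) ×-dec (z′ <? j) ×-dec
                               (fun σ j <? fun σ z) ×-dec (fun σ z <? fun σ z′) ×-dec (fun σ z′ <? fun σ i))))
  where
  fromSum = λ { (inj₁ lt) → ascent lt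
              ; (inj₂ (inj₁ (z , a , b , c))) → gap-before z a b c
              ; (inj₂ (inj₂ (inj₁ (z , a , b , c)))) → gap-after z a b c
              ; (inj₂ (inj₂ (inj₂ (z , z′ , a , b , c , d , e , f)))) → inner-ascent z z′ a b c d e f }
  toSum = λ { (ascent lt) → inj₁ lt
            ; (gap-before z a b c) → inj₂ (inj₁ (z , a , b , c))
            ; (gap-after z a b c) → inj₂ (inj₂ (inj₁ (z , a , b , c)))
            ; (inner-ascent z z′ a b c d e f) → inj₂ (inj₂ (inj₂ (z , z′ , a , b , c , d , e , f))) }

Conflicting : ∀ {n} → Perm n → Fin n → Fin n → Set
Conflicting σ i j = (i <ᶠ j × Conflict σ i j) ⊎ (j <ᶠ i × Conflict σ j i)

conflicting? : ∀ {n} (σ : Perm n) i j → Dec (Conflicting σ i j)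
conflicting? σ i j = ((i <? j) ×-dec conflict? σ i j) ⊎-dec ((j <? i) ×-dec conflict? σ j i)

record Obstruction (k : ℕ) {n : ℕ} (σ : Perm n) : Set where
  constructor obstruction
  field
    pivot    : Fin n
    blockers : Vec (Fin n) (suc k)
    before   : ∀ a → lookup blockers a <ᶠ pivot
    above    : ∀ a → fun σ pivot <ᶠ fun σ (lookup blockers a)
    conflict : ∀ a b → a ≢ b → Conflicting σ (lookup blockers a) (lookup blockers b)

witnesses : ∀ {n} {π : Perm n} {i j} → Conflict π i j → List (Fin n)
witnesses (ascent _)                       = []
witnesses (gap-before z _ _ _)             = z ∷ []
witnesses (gap-after z _ _ _)              = z ∷ []
witnesses (inner-ascent z z′ _ _ _ _ _ _)  = z ∷ z′ ∷ []

length-witnesses : ∀ {n} {π : Perm n} {i j} (c : Conflict π i j) → length (witnesses c) ≤ 2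
length-witnesses (ascent _)                      = z≤n
length-witnesses (gap-before _ _ _ _)            = s≤s z≤n
length-witnesses (gap-after _ _ _ _)             = s≤s z≤n
length-witnesses (inner-ascent _ _ _ _ _ _ _ _)  = ≤-refl

witnessesᶜ : ∀ {n} {π : Perm n} {i j} → Conflicting π i j → List (Fin n)
witnessesᶜ (inj₁ (_ , c)) = witnesses c
witnessesᶜ (inj₂ (_ , c)) = witnesses c

length-witnessesᶜ : ∀ {n} {π : Perm n} {i j} (c : Conflicting π i j) → length (witnessesᶜ c) ≤ 2
length-witnessesᶜ (inj₁ (_ , c)) = length-witnesses c
length-witnessesᶜ (inj₂ (_ , c)) = length-witnesses c

module _ {n m} {π : Perm n} {σ : Perm m} (f : Fin m → Fin n) (f-emb : IsEmbedding π σ f) where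

  private
    f-mono = proj₁ f-emb
    f-iso  = proj₂ f-emb
    reflects = IsEmbedding-reflects-< {π = π} {σ} f f-emb

  Conflict-embed : ∀ {i j} → Conflict σ i j → Conflict π (f i) (f j)
  Conflict-embed {i} {j} (ascent lt) = ascent (to (f-iso i j) lt)
  Conflict-embed {i} {j} (gap-before z a b c) = gap-before (f z) (to (f-iso j z) a) (to (f-iso z i) b) (f-mono z i c)
  Conflict-embed {i} {j} (gap-after z a b c) = gap-after (f z) (to (f-iso j z) a) (to (f-iso z i) b) (f-mono j z c)
  Conflict-embed {i} {j} (inner-ascent z z′ a b c d e g) =
    inner-ascent (f z) (f z′) (f-mono i z a) (f-mono z z′ b) (f-mono z′ j c)
                 (to (f-iso j z) d) (to (f-iso z z′) e) (to (f-iso z′ i) g)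

  Conflicting-embed : ∀ {i j} → Conflicting σ i j → Conflicting π (f i) (f j)
  Conflicting-embed (inj₁ (i<j , c)) = inj₁ (f-mono _ _ i<j , Conflict-embed c)
  Conflicting-embed (inj₂ (j<i , c)) = inj₂ (f-mono _ _ j<i , Conflict-embed c)

  Obstruction-embed : ∀ {k} → Obstruction k σ → Obstruction k π
  Obstruction-embed (obstruction c q q<c πc<πq q-conf) =
    obstruction (f c) (mapⱽ f q)
      (λ a → subst (_<ᶠ f c) (sym (lookup-map a f q)) (f-mono _ _ (q<c a)))
      (λ a → subst (λ x → fun π (f c) <ᶠ fun π x) (sym (lookup-map a f q)) (to (f-iso _ _) (πc<πq a)))
      (λ a b a≢b → subst₂ (Conflicting π) (sym (lookup-map a f q)) (sym (lookup-map b f q))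
                          (Conflicting-embed (q-conf a b a≢b)))

  Conflict-pull : ∀ {i j} (c : Conflict π (f i) (f j)) → InImage f (witnesses c) → Conflict σ i j
  Conflict-pull {i} {j} (ascent lt) _ = ascent (from (f-iso i j) lt)
  Conflict-pull {i} {j} (gap-before _ a b c) pre with z , refl ← pre (here refl) =
    gap-before z (from (f-iso j z) a) (from (f-iso z i) b) (reflects z i c)
  Conflict-pull {i} {j} (gap-after _ a b c) pre with z , refl ← pre (here refl) =
    gap-after z (from (f-iso j z) a) (from (f-iso z i) b) (reflects j z c)
  Conflict-pull {i} {j} (inner-ascent _ _ a b c d e g) pre
    with z , refl ← pre (here refl) | z′ , refl ← pre (there (here refl)) =
    inner-ascent z z′ (reflects i z a) (reflects z z′ b) (reflects z′ j c)
                 (from (f-iso j z) d) (from (f-iso z z′) e) (from (f-iso z′ i) g)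

  Conflicting-pull : ∀ {i j x y} → f i ≡ x → f j ≡ y → (c : Conflicting π x y) →
                     InImage f (witnessesᶜ c) → Conflicting σ i j
  Conflicting-pull {i} {j} refl refl (inj₁ (lt , c)) pre = inj₁ (reflects i j lt , Conflict-pull c pre)
  Conflicting-pull {i} {j} refl refl (inj₂ (lt , c)) pre = inj₂ (reflects j i lt , Conflict-pull c pre)

-- The device on a fixed input

module Device (k : ℕ) {n : ℕ} (π : Perm n) where

  val : Fin n → ℕ
  val j = toℕ (fun π j)

  val-injective : ∀ {j j′} → val j ≡ val j′ → j ≡ j′
  val-injective eq = inj π (toℕ-injective eq)

  Read : ℕ → ℕ → Set
  Read i v = ∃ λ j → toℕ j < i × val j ≡ v

  Read-suc : ∀ {i v} → Read i v → Read (suc i) v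
  Read-suc (j , j<i , eq) = j , m<n⇒m<1+n j<i , eq

  Read-new : ∀ p → Read (suc (toℕ p)) (val p)
  Read-new p = p , ≤-refl , refl

  Read-suc⁻ : ∀ {v} p → Read (suc (toℕ p)) v → Read (toℕ p) v ⊎ v ≡ val p
  Read-suc⁻ p (j , j<1+p , eq) with m≤n⇒m<n∨m≡n (s≤s⁻¹ j<1+p)
  ... | inj₁ j<p = inj₁ (j , j<p , eq)
  ... | inj₂ j≡p = inj₂ (trans (sym eq) (cong val (toℕ-injective j≡p)))

  ¬Read-own : ∀ p → ¬ Read (toℕ p) (val p)
  ¬Read-own p (j , j<p , eq) with refl ← val-injective eq = <-irrefl refl j<p

  Read⇒<n : ∀ {i v} → Read i v → v < n
  Read⇒<n (j , _ , refl) = toℕ<n (fun π j)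

  initial : Config k
  initial = config (word π) (replicate k []) []

  final : Config k
  final = config [] (replicate k []) (upTo n)

  Run : Config k → Set
  Run C = Star (Step k) C final

  _After_ : ℕ → ℕ → Set
  v After u = ∀ j j′ → val j ≡ v → val j′ ≡ u → j′ <ᶠ j

  Completion : Config k → Set
  Completion (config _ sts out) = ∃ λ rest → out ++ rest ≡ upTo n ×
    ∀ s → ∃₂ λ pre suf → rest ≡ pre ++ lookup sts s ++ suf

  completion : ∀ {C} → Run C → Completion C
  completion ε = [] , ++-identityʳ _ , λ s → [] , [] , cong (_++ []) (sym (lookup-replicate s []))
  completion (push {x} {sts = sts} s ◅ run) with rest , done , blocks ← completion run =
    rest , done , block
    where
    block : ∀ s′ → ∃₂ λ pre suf → rest ≡ pre ++ lookup sts s′ ++ suf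
    block s′ with s ≟ᶠ s′ | blocks s′
    ... | yes refl | pre , suf , eq = pre ++ x ∷ [] , suf ,
          trans eq (trans (cong (λ l → pre ++ l ++ suf) (lookup∘update s sts _)) (sym (++-assoc pre (x ∷ []) _)))
    ... | no s≢s′  | pre , suf , eq = pre , suf , trans eq (cong (λ l → pre ++ l ++ suf) (lookup∘update′ (s≢s′ ∘ sym) sts _))
  completion (pop {sts = sts} {out} s ◅ run) with rest , done , blocks ← completion run =
    lookup sts s ++ rest , trans (sym (++-assoc out _ rest)) done , block
    where
    block : ∀ s′ → ∃₂ λ pre suf → lookup sts s ++ rest ≡ pre ++ lookup sts s′ ++ suf
    block s′ with s ≟ᶠ s′ | blocks s′
    ... | yes refl | _ = [] , rest , refl
    ... | no s≢s′  | pre , suf , eq = lookup sts s ++ pre , suf ,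
          trans (cong (lookup sts s ++_) (trans eq (cong (λ l → pre ++ l ++ suf) (lookup∘update′ (s≢s′ ∘ sym) sts _))))
                (sym (++-assoc (lookup sts s) pre _))
  completion (bypass {x} {out = out} ◅ run) with rest , done , blocks ← completion run =
    x ∷ rest , trans (sym (++-assoc out (x ∷ []) rest)) done ,
    λ s′ → let pre , suf , eq = blocks s′ in x ∷ pre , suf , cong (x ∷_) eq

  record Stage (i : ℕ) (C : Config k) : Set where
    field
      input-rest   : Config.input C ≡ drop i (word π)
      read-placed  : ∀ {v} → Read i v → v ∈ Config.output C ⊎ ∃ λ s → v ∈ lookup (Config.stacks C) s
      output-read  : ∀ {v} → v ∈ Config.output C → Read i v
      stacked-read : ∀ s {v} → v ∈ lookup (Config.stacks C) s → Read i v
      stack-order  : ∀ s → AllPairs _After_ (lookup (Config.stacks C) s)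
  open Stage

  Stage-initial : Stage 0 initial
  Stage-initial = record
    { input-rest   = refl
    ; read-placed  = λ ()
    ; output-read  = λ ()
    ; stacked-read = λ s v∈ → ⊥-elim (∉[] (subst (_ ∈_) (lookup-replicate s []) v∈))
    ; stack-order  = λ s → subst (AllPairs _After_) (sym (lookup-replicate s [])) [] }
    where
    ∉[] : ∀ {v : ℕ} → ¬ v ∈ []
    ∉[] ()

  Stage-push : ∀ {i x inp sts out} s → Stage i (config (x ∷ inp) sts out) →
               Stage (suc i) (config inp (sts [ s ]≔ (x ∷ lookup sts s)) out)
  Stage-push {i} {x} {inp} {sts} {out} s st
    with p , refl , refl , rest ← drop-tabulate-∷⁻ val i (sym (input-rest st)) = record
    { input-rest   = sym rest
    ; read-placed  = placed
    ; output-read  = Read-suc ∘ output-read st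
    ; stacked-read = stacked
    ; stack-order  = order }
    where
    sts′ = sts [ s ]≔ (val p ∷ lookup sts s)
    placed : ∀ {v} → Read (suc (toℕ p)) v → v ∈ out ⊎ ∃ λ s′ → v ∈ lookup sts′ s′
    placed r with Read-suc⁻ p r
    ... | inj₂ refl = inj₂ (s , subst (val p ∈_) (sym (lookup∘update s sts _)) (here refl))
    ... | inj₁ r′ with read-placed st r′
    ...   | inj₁ v∈out = inj₁ v∈out
    ...   | inj₂ (s′ , v∈) with s ≟ᶠ s′
    ...     | yes refl = inj₂ (s , subst (_ ∈_) (sym (lookup∘update s sts _)) (there v∈))
    ...     | no s≢s′  = inj₂ (s′ , subst (_ ∈_) (sym (lookup∘update′ (s≢s′ ∘ sym) sts _)) v∈)
    stacked : ∀ s′ {v} → v ∈ lookup sts′ s′ → Read (suc (toℕ p)) v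
    stacked s′ v∈ with ∈-update sts s s′ v∈
    ... | inj₁ (refl , here refl) = Read-new p
    ... | inj₁ (refl , there v∈′) = Read-suc (stacked-read st s v∈′)
    ... | inj₂ (_ , v∈′)          = Read-suc (stacked-read st s′ v∈′)
    order : ∀ s′ → AllPairs _After_ (lookup sts′ s′)
    order s′ with s ≟ᶠ s′
    ... | no s≢s′  = subst (AllPairs _After_) (sym (lookup∘update′ (s≢s′ ∘ sym) sts _)) (stack-order st s′)
    ... | yes refl = subst (AllPairs _After_) (sym (lookup∘update s sts _)) (tabulateᴬ new-after ∷ stack-order st s)
      where
      new-after : ∀ {u} → u ∈ lookup sts s → val p After u
      new-after u∈ j j′ j↦p j′↦u with j″ , j″<p , j″↦u ← stacked-read st s u∈ =
        subst₂ _<ᶠ_ (val-injective (trans j″↦u (sym j′↦u))) (val-injective (sym j↦p)) j″<p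

  Stage-pop : ∀ {i inp sts out} s → Stage i (config inp sts out) →
              Stage i (config inp (sts [ s ]≔ []) (out ++ lookup sts s))
  Stage-pop {i} {inp} {sts} {out} s st = record
    { input-rest   = input-rest st
    ; read-placed  = placed
    ; output-read  = outputs
    ; stacked-read = stacked
    ; stack-order  = order }
    where
    placed : ∀ {v} → Read i v → v ∈ out ++ lookup sts s ⊎ ∃ λ s′ → v ∈ lookup (sts [ s ]≔ []) s′
    placed r with read-placed st r
    ... | inj₁ v∈out = inj₁ (∈-++⁺ˡ v∈out)
    ... | inj₂ (s′ , v∈) with s ≟ᶠ s′
    ...   | yes refl = inj₁ (∈-++⁺ʳ out v∈)
    ...   | no s≢s′  = inj₂ (s′ , subst (_ ∈_) (sym (lookup∘update′ (s≢s′ ∘ sym) sts _)) v∈)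
    outputs : ∀ {v} → v ∈ out ++ lookup sts s → Read i v
    outputs v∈ with ∈-++⁻ out v∈
    ... | inj₁ v∈out = output-read st v∈out
    ... | inj₂ v∈s   = stacked-read st s v∈s
    stacked : ∀ s′ {v} → v ∈ lookup (sts [ s ]≔ []) s′ → Read i v
    stacked s′ v∈ with ∈-update sts s s′ v∈
    ... | inj₁ (refl , ())
    ... | inj₂ (_ , v∈′) = stacked-read st s′ v∈′
    order : ∀ s′ → AllPairs _After_ (lookup (sts [ s ]≔ []) s′)
    order s′ with s ≟ᶠ s′
    ... | yes refl = subst (AllPairs _After_) (sym (lookup∘update s sts [])) []
    ... | no s≢s′  = subst (AllPairs _After_) (sym (lookup∘update′ (s≢s′ ∘ sym) sts [])) (stack-order st s′)

  Stage-bypass : ∀ {i x inp sts out} → Stage i (config (x ∷ inp) sts out) →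
                 Stage (suc i) (config inp sts (out ++ x ∷ []))
  Stage-bypass {i} {x} {inp} {sts} {out} st
    with p , refl , refl , rest ← drop-tabulate-∷⁻ val i (sym (input-rest st)) = record
    { input-rest   = sym rest
    ; read-placed  = placed
    ; output-read  = outputs
    ; stacked-read = λ s → Read-suc ∘ stacked-read st s
    ; stack-order  = stack-order st }
    where
    placed : ∀ {v} → Read (suc (toℕ p)) v → v ∈ out ++ val p ∷ [] ⊎ ∃ λ s → v ∈ lookup sts s
    placed r with Read-suc⁻ p r
    ... | inj₂ refl = inj₁ (∈-++⁺ʳ out (here refl))
    ... | inj₁ r′ with read-placed st r′
    ...   | inj₁ v∈out = inj₁ (∈-++⁺ˡ v∈out)
    ...   | inj₂ v∈s   = inj₂ v∈s
    outputs : ∀ {v} → v ∈ out ++ val p ∷ [] → Read (suc (toℕ p)) v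
    outputs v∈ with ∈-++⁻ out v∈
    ... | inj₁ v∈out      = Read-suc (output-read st v∈out)
    ... | inj₂ (here refl) = Read-new p

  advance : ∀ {C} i → Stage i C → Run C → ∀ t → i ≤ t → t ≤ n → ∃ λ C′ → Stage t C′ × Run C′
  advance i st run t i≤t t≤n with i ≟ℕ t
  ... | yes refl = _ , st , run
  advance i st ε            t i≤t t≤n | no i≢t =
    ⊥-elim (drop-tabulate-≢[] val i (<-≤-trans (≤∧≢⇒< i≤t i≢t) t≤n) (sym (input-rest st)))
  advance i st (push s ◅ run) t i≤t t≤n | no i≢t = advance (suc i) (Stage-push s st) run t (≤∧≢⇒< i≤t i≢t) t≤n
  advance i st (pop s ◅ run)  t i≤t t≤n | no i≢t = advance i (Stage-pop s st) run t i≤t t≤n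
  advance i st (bypass ◅ run) t i≤t t≤n | no i≢t = advance (suc i) (Stage-bypass st) run t (≤∧≢⇒< i≤t i≢t) t≤n

  -- Stacks are decreasing in reading order, and the values they output form intervals.
  interval-conflict-free : ∀ a m → AllPairs _After_ (range a m) →
                           ∀ {i j} → val i ∈ range a m → val j ∈ range a m → ¬ Conflicting π i j
  interval-conflict-free a m ordered i∈ j∈ (inj₁ (i<j , c)) = no-conflict i<j c i∈ j∈
    where
    later : ∀ {z z′} → val z ∈ range a m → val z′ ∈ range a m → val z < val z′ → z′ <ᶠ z
    later z∈ z′∈ lt = AllPairs-range a m ordered z∈ z′∈ lt _ _ refl refl
    between : ∀ {x y z} → x ∈ range a m → y ∈ range a m → x < z → z < y → z ∈ range a m
    between = ∈-range-convex a m
    no-conflict : ∀ {i j} → i <ᶠ j → Conflict π i j → val i ∈ range a m → val j ∈ range a m → ⊥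
    no-conflict i<j (ascent lt) i∈ j∈ = <-asym i<j (later i∈ j∈ lt)
    no-conflict i<j (gap-before z jz zi z<i) i∈ j∈ = <-asym z<i (later (between j∈ i∈ jz zi) i∈ zi)
    no-conflict i<j (gap-after z jz zi j<z) i∈ j∈ = <-asym j<z (later j∈ (between j∈ i∈ jz zi) jz)
    no-conflict i<j (inner-ascent z z′ _ z<z′ _ jz zz′ z′i) i∈ j∈ =
      <-asym z<z′ (later (between j∈ i∈ jz (<-trans zz′ z′i)) (between j∈ i∈ (<-trans jz zz′) z′i) zz′)
  interval-conflict-free a m ordered i∈ j∈ (inj₂ (j<i , c)) =
    interval-conflict-free a m ordered j∈ i∈ (inj₁ (j<i , c))

  sortable⇒¬Obstruction : Run initial → ¬ Obstruction k π
  sortable⇒¬Obstruction run (obstruction c q q<c c<q q-conf)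
    with config inp sts out , st , run′ ← advance 0 Stage-initial run (toℕ c) z≤n (toℕ≤n c)
    with rest , done , blocks ← completion run′
    = no-shared-stack (pigeonhole ≤-refl (proj₁ ∘ stacked))
    where
    remaining : range 0 n ≡ out ++ rest
    remaining = trans (sym (upTo-range n)) (sym done)
    output-prefix : out ≡ range 0 (length out)
    output-prefix = range-prefix 0 n out rest remaining
    -- The output is an initial segment of values not containing the unread pivot, hence nothing above it.
    not-output : ∀ a → ¬ val (lookup q a) ∈ out
    not-output a v∈ with _ , v<len ← ∈-range⁻ 0 (length out) (subst (_ ∈_) output-prefix v∈) =
      ¬Read-own c (output-read st (subst (_ ∈_) (sym output-prefix) (∈-range⁺ 0 _ z≤n (<-trans (c<q a) v<len))))
    stacked : ∀ a → ∃ λ s → val (lookup q a) ∈ lookup sts s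
    stacked a with read-placed st (lookup q a , q<c a , refl)
    ... | inj₁ v∈out = ⊥-elim (not-output a v∈out)
    ... | inj₂ v∈s   = v∈s
    stack-interval : ∀ s → ∃ λ lo → lookup sts s ≡ range lo (length (lookup sts s))
    stack-interval s with pre , suf , eq ← blocks s =
      range-infix 0 n (out ++ pre) _ suf (trans remaining (trans (cong (out ++_) eq) (sym (++-assoc out pre _))))
    no-shared-stack : ¬ ∃₂ λ a b → a <ᶠ b × proj₁ (stacked a) ≡ proj₁ (stacked b)
    no-shared-stack (a , b , a<b , same) with lo , eq ← stack-interval (proj₁ (stacked a)) =
      interval-conflict-free lo _ (subst (AllPairs _After_) eq (stack-order st _))
        (subst (_ ∈_) eq (proj₂ (stacked a)))
        (subst (_ ∈_) eq (subst (λ s → _ ∈ lookup sts s) (sym same) (proj₂ (stacked b))))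
        (q-conf a b (<⇒≢ᶠ a<b))

  -- c is the next value to output.
  record Greedy (i : ℕ) (C : Config k) (c : ℕ) : Set where
    field
      unread     : Config.input C ≡ drop i (word π)
      emitted    : Config.output C ≡ upTo c
      below-read : ∀ {v} → v < c → Read i v
      interval   : ∀ s → ∃ λ lo → lookup (Config.stacks C) s ≡ range lo (length (lookup (Config.stacks C) s))
      held-read  : ∀ s {v} → v ∈ lookup (Config.stacks C) s → Read i v
      held-≥     : ∀ s {v} → v ∈ lookup (Config.stacks C) s → c ≤ v
      held-once  : ∀ s s′ {v} → v ∈ lookup (Config.stacks C) s → v ∈ lookup (Config.stacks C) s′ → s ≡ s′
      read-held  : ∀ {v} → Read i v → c ≤ v → ∃ λ s → v ∈ lookup (Config.stacks C) s
      top-order  : ∀ s {a rest} → lookup (Config.stacks C) s ≡ suc a ∷ rest → c ≤ a →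
                   ∀ j j′ → val j ≡ a → val j′ ≡ suc a → toℕ j < i → j <ᶠ j′
  open Greedy

  Greedy-initial : Greedy 0 initial 0
  Greedy-initial = record
    { unread     = refl
    ; emitted    = refl
    ; below-read = λ ()
    ; interval   = λ s → 0 , trans empty (cong (range 0 ∘ length) (sym empty))
    ; held-read  = λ s v∈ → ⊥-elim (∉-empty s v∈)
    ; held-≥     = λ s v∈ → ⊥-elim (∉-empty s v∈)
    ; held-once  = λ s s′ v∈ → ⊥-elim (∉-empty s v∈)
    ; read-held  = λ ()
    ; top-order  = λ s top≡ → ⊥-elim (nonempty (trans (sym empty) top≡)) }
    where
    empty : ∀ {s} → lookup (replicate k []) s ≡ []
    empty {s} = lookup-replicate s []
    ∉-empty : ∀ s {v} → ¬ v ∈ lookup (replicate k []) s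
    ∉-empty s v∈ with () ← subst (_ ∈_) empty v∈
    nonempty : ∀ {x : ℕ} {xs} → ¬ _≡_ {A = List ℕ} [] (x ∷ xs)
    nonempty ()

  Greedy-pop : ∀ {i inp sts out c} s m → lookup sts s ≡ range c m → Greedy i (config inp sts out) c →
               Greedy i (config inp (sts [ s ]≔ []) (out ++ lookup sts s)) (c + m)
  Greedy-pop {i} {inp} {sts} {out} {c} s m s≡ g = record
    { unread     = unread g
    ; emitted    = trans (cong₂ _++_ (emitted g) s≡) (upTo-++-range c m)
    ; below-read = below
    ; interval   = interval′
    ; held-read  = λ s′ v∈ → held-read g s′ (old s′ v∈)
    ; held-≥     = ≥
    ; held-once  = λ s₁ s₂ v∈₁ v∈₂ → held-once g s₁ s₂ (old s₁ v∈₁) (old s₂ v∈₂)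
    ; read-held  = held
    ; top-order  = top }
    where
    sts′ = sts [ s ]≔ []
    kept : ∀ {s′} → s ≢ s′ → lookup sts′ s′ ≡ lookup sts s′
    kept s≢s′ = lookup∘update′ (s≢s′ ∘ sym) sts []
    in-popped : ∀ {v} → c ≤ v → v < c + m → v ∈ lookup sts s
    in-popped c≤v v<c+m = subst (_ ∈_) (sym s≡) (∈-range⁺ c m c≤v v<c+m)
    old : ∀ s′ {v} → v ∈ lookup sts′ s′ → v ∈ lookup sts s′
    old s′ v∈ with ∈-update sts s s′ v∈
    ... | inj₁ (refl , ())
    ... | inj₂ (_ , v∈′) = v∈′
    below : ∀ {v} → v < c + m → Read i v
    below {v} v<c+m with v <?ℕ c
    ... | yes v<c = below-read g v<c
    ... | no v≮c  = held-read g s (in-popped (≮⇒≥ v≮c) v<c+m)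
    interval′ : ∀ s′ → ∃ λ lo → lookup sts′ s′ ≡ range lo (length (lookup sts′ s′))
    interval′ s′ with s ≟ᶠ s′
    ... | yes refl = 0 , trans (lookup∘update s sts []) (cong (range 0 ∘ length) (sym (lookup∘update s sts [])))
    ... | no s≢s′  = subst (λ l → ∃ λ lo → l ≡ range lo (length l)) (sym (kept s≢s′)) (interval g s′)
    ≥ : ∀ s′ {v} → v ∈ lookup sts′ s′ → c + m ≤ v
    ≥ s′ {v} v∈ with ∈-update sts s s′ v∈
    ... | inj₁ (refl , ())
    ... | inj₂ (s≢s′ , v∈′) with v <?ℕ c + m
    ...   | no v≮ = ≮⇒≥ v≮
    ...   | yes v< = ⊥-elim (s≢s′ (held-once g s s′ (in-popped (held-≥ g s′ v∈′) v<) v∈′))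
    held : ∀ {v} → Read i v → c + m ≤ v → ∃ λ s′ → v ∈ lookup sts′ s′
    held r c+m≤v with read-held g r (≤-trans (m≤m+n c m) c+m≤v)
    ... | s′ , v∈ with s ≟ᶠ s′
    ...   | yes refl = ⊥-elim (<⇒≱ (proj₂ (∈-range⁻ c m (subst (_ ∈_) s≡ v∈))) c+m≤v)
    ...   | no s≢s′  = s′ , subst (_ ∈_) (sym (kept s≢s′)) v∈
    top : ∀ s′ {a rest} → lookup sts′ s′ ≡ suc a ∷ rest → c + m ≤ a →
          ∀ j j′ → val j ≡ a → val j′ ≡ suc a → toℕ j < i → j <ᶠ j′
    top s′ top≡ c+m≤a with s ≟ᶠ s′
    ... | yes refl with () ← trans (sym (lookup∘update s sts [])) top≡
    ... | no s≢s′  = top-order g s′ (trans (sym (kept s≢s′)) top≡) (≤-trans (m≤m+n c m) c+m≤a)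

  read? : ∀ i v → Dec (Read i v)
  read? i v = any? λ j → (toℕ j <?ℕ i) ×-dec (val j ≟ℕ v)

  -- The next value, once read, sits on top of its stack: stacks are intervals of values ≥ c.
  next-on-top : ∀ {i C c} → Greedy i C c → Read i c → ∃₂ λ s m → lookup (Config.stacks C) s ≡ range c (suc m)
  next-on-top {C = config _ sts _} {c} g r
    with s , c∈ ← read-held g r ≤-refl
    with lo , s≡ ← interval g s
    with m , l≡ ← ∈-range⇒nonempty lo _ (subst (_ ∈_) s≡ c∈)
    with lo≤c , c<lo+l ← ∈-range⁻ lo _ (subst (_ ∈_) s≡ c∈)
    with refl ← ≤-antisym lo≤c (held-≥ g s (subst (_ ∈_) (sym s≡) (∈-range⁺ lo _ ≤-refl (≤-<-trans lo≤c c<lo+l))))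
    = s , m , trans s≡ (cong (range lo) l≡)

  -- Pop while the next value has been read; each pop raises c, which stays below n, so n pops suffice.
  cascade : ∀ fuel {i C c} → n ≤ c + fuel → Greedy i C c →
            ∃₂ λ C′ c′ → Greedy i C′ c′ × ¬ Read i c′ × Star (Step k) C C′
  cascade fuel {i} {C} {c} bound g with read? i c
  ... | no ¬r = C , c , g , ¬r , ε
  ... | yes r with fuel | next-on-top g r
  ...   | zero     | _ = ⊥-elim (<⇒≱ (Read⇒<n r) (subst (n ≤_) (+-identityʳ c) bound))
  ...   | suc fuel | s , m , s≡ =
    let C′ , c′ , g′ , ¬r′ , steps = cascade fuel bound′ (Greedy-pop s (suc m) s≡ g)
    in  C′ , c′ , g′ , ¬r′ , pop s ◅ steps
    where
    bound′ : n ≤ c + suc m + fuel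
    bound′ = ≤-trans bound (≤-trans (+-monoʳ-≤ c (s≤s (m≤n+m fuel m))) (≤-reflexive (sym (+-assoc c (suc m) fuel))))

  unread-step : ∀ {inp} p → val p ∷ inp ≡ drop (toℕ p) (word π) → inp ≡ drop (suc (toℕ p)) (word π)
  unread-step p eq = proj₂ (∷-injective (trans eq (drop-tabulate val p)))

  ¬Read-suc : ∀ {c} p → ¬ Read (toℕ p) c → c ≢ val p → ¬ Read (suc (toℕ p)) c
  ¬Read-suc p ¬r c≢p r with Read-suc⁻ p r
  ... | inj₁ r′   = ¬r r′
  ... | inj₂ c≡p  = c≢p c≡p

  Greedy-push : ∀ {inp sts out c} p s m → c < val p → lookup sts s ≡ range (suc (val p)) m →
                (∀ s′ → s′ ≢ s → ¬ suc (val p) ∈ lookup sts s′) →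
                Greedy (toℕ p) (config (val p ∷ inp) sts out) c →
                Greedy (suc (toℕ p)) (config inp (sts [ s ]≔ (val p ∷ lookup sts s)) out) c
  Greedy-push {inp} {sts} {out} {c} p s m c<x s≡ x+1-only-in-s g = record
    { unread     = unread-step p (unread g)
    ; emitted    = emitted g
    ; below-read = Read-suc ∘ below-read g
    ; interval   = interval′
    ; held-read  = held-read′
    ; held-≥     = ≥
    ; held-once  = once
    ; read-held  = held
    ; top-order  = top }
    where
    x = val p
    sts′ = sts [ s ]≔ (x ∷ lookup sts s)
    pushed : lookup sts′ s ≡ x ∷ lookup sts s
    pushed = lookup∘update s sts _
    kept : ∀ {s′} → s ≢ s′ → lookup sts′ s′ ≡ lookup sts s′
    kept s≢s′ = lookup∘update′ (s≢s′ ∘ sym) sts _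
    interval′ : ∀ s′ → ∃ λ lo → lookup sts′ s′ ≡ range lo (length (lookup sts′ s′))
    interval′ s′ with s ≟ᶠ s′
    ... | no s≢s′  = subst (λ l → ∃ λ lo → l ≡ range lo (length l)) (sym (kept s≢s′)) (interval g s′)
    ... | yes refl = x , trans pushed (trans (∷-range x m s≡) (cong (range x ∘ length) (sym pushed)))
    held-read′ : ∀ s′ {v} → v ∈ lookup sts′ s′ → Read (suc (toℕ p)) v
    held-read′ s′ v∈ with ∈-update sts s s′ v∈
    ... | inj₁ (refl , here refl) = Read-new p
    ... | inj₁ (refl , there v∈′) = Read-suc (held-read g s v∈′)
    ... | inj₂ (_ , v∈′)          = Read-suc (held-read g s′ v∈′)
    ≥ : ∀ s′ {v} → v ∈ lookup sts′ s′ → c ≤ v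
    ≥ s′ v∈ with ∈-update sts s s′ v∈
    ... | inj₁ (refl , here refl) = <⇒≤ c<x
    ... | inj₁ (refl , there v∈′) = held-≥ g s v∈′
    ... | inj₂ (_ , v∈′)          = held-≥ g s′ v∈′
    x-unheld : ∀ s′ → ¬ x ∈ lookup sts s′
    x-unheld s′ x∈ = ¬Read-own p (held-read g s′ x∈)
    once : ∀ s₁ s₂ {v} → v ∈ lookup sts′ s₁ → v ∈ lookup sts′ s₂ → s₁ ≡ s₂
    once s₁ s₂ v∈₁ v∈₂ with ∈-update sts s s₁ v∈₁ | ∈-update sts s s₂ v∈₂
    ... | inj₁ (refl , _)          | inj₁ (refl , _)          = refl
    ... | inj₁ (refl , here refl)  | inj₂ (_ , x∈)            = ⊥-elim (x-unheld s₂ x∈)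
    ... | inj₂ (_ , x∈)            | inj₁ (refl , here refl)  = ⊥-elim (x-unheld s₁ x∈)
    ... | inj₁ (refl , there v∈₁′) | inj₂ (_ , v∈₂′)          = held-once g s s₂ v∈₁′ v∈₂′
    ... | inj₂ (_ , v∈₁′)          | inj₁ (refl , there v∈₂′) = held-once g s₁ s v∈₁′ v∈₂′
    ... | inj₂ (_ , v∈₁′)          | inj₂ (_ , v∈₂′)          = held-once g s₁ s₂ v∈₁′ v∈₂′
    held : ∀ {v} → Read (suc (toℕ p)) v → c ≤ v → ∃ λ s′ → v ∈ lookup sts′ s′
    held r c≤v with Read-suc⁻ p r
    ... | inj₂ refl = s , subst (x ∈_) (sym pushed) (here refl)
    ... | inj₁ r′ with read-held g r′ c≤v
    ...   | s′ , v∈ with s ≟ᶠ s′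
    ...     | yes refl = s , subst (_ ∈_) (sym pushed) (there v∈)
    ...     | no s≢s′  = s′ , subst (_ ∈_) (sym (kept s≢s′)) v∈
    top : ∀ s′ {a rest} → lookup sts′ s′ ≡ suc a ∷ rest → c ≤ a →
          ∀ j j′ → val j ≡ a → val j′ ≡ suc a → toℕ j < suc (toℕ p) → j <ᶠ j′
    top s′ top≡ c≤a j j′ j↦a j′↦a+1 j≤p with s ≟ᶠ s′ | m≤n⇒m<n∨m≡n (s≤s⁻¹ j≤p)
    ... | yes refl | j<p with x≡a+1 ← proj₁ (∷-injective (trans (sym pushed) top≡))
                         with refl ← val-injective (trans j′↦a+1 (sym x≡a+1)) with j<p
    ...   | inj₁ j<p′ = j<p′
    ...   | inj₂ j≡p with refl ← toℕ-injective j≡p = ⊥-elim (1+n≢n (trans (sym j′↦a+1) j↦a))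
    top s′ top≡ c≤a j j′ j↦a j′↦a+1 j≤p | no s≢s′ | inj₁ j<p =
      top-order g s′ (trans (sym (kept s≢s′)) top≡) c≤a j j′ j↦a j′↦a+1 j<p
    top s′ top≡ c≤a j j′ j↦a j′↦a+1 j≤p | no s≢s′ | inj₂ j≡p with refl ← toℕ-injective j≡p =
      ⊥-elim (x+1-only-in-s s′ (s≢s′ ∘ sym) (subst (_ ∈_) (sym (trans (sym (kept s≢s′)) top≡)) (here (cong suc j↦a))))

  Greedy-bypass : ∀ {inp sts out} p → Greedy (toℕ p) (config (val p ∷ inp) sts out) (val p) →
                  Greedy (suc (toℕ p)) (config inp sts (out ++ val p ∷ [])) (suc (val p))
  Greedy-bypass {inp} {sts} {out} p g = record
    { unread     = unread-step p (unread g)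
    ; emitted    = trans (cong (_++ val p ∷ []) (emitted g)) (upTo-∷ʳ (val p))
    ; below-read = below
    ; interval   = interval g
    ; held-read  = λ s → Read-suc ∘ held-read g s
    ; held-≥     = ≥
    ; held-once  = held-once g
    ; read-held  = held
    ; top-order  = top }
    where
    below : ∀ {v} → v < suc (val p) → Read (suc (toℕ p)) v
    below v≤x with m≤n⇒m<n∨m≡n (s≤s⁻¹ v≤x)
    ... | inj₁ v<x = Read-suc (below-read g v<x)
    ... | inj₂ refl = Read-new p
    ≥ : ∀ s {v} → v ∈ lookup sts s → suc (val p) ≤ v
    ≥ s v∈ with m≤n⇒m<n∨m≡n (held-≥ g s v∈)
    ... | inj₁ x<v = x<v
    ... | inj₂ refl = ⊥-elim (¬Read-own p (held-read g s v∈))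
    held : ∀ {v} → Read (suc (toℕ p)) v → suc (val p) ≤ v → ∃ λ s → v ∈ lookup sts s
    held r x<v with Read-suc⁻ p r
    ... | inj₁ r′   = read-held g r′ (<⇒≤ x<v)
    ... | inj₂ refl = ⊥-elim (<-irrefl refl x<v)
    top : ∀ s {a rest} → lookup sts s ≡ suc a ∷ rest → suc (val p) ≤ a →
          ∀ j j′ → val j ≡ a → val j′ ≡ suc a → toℕ j < suc (toℕ p) → j <ᶠ j′
    top s top≡ x<a j j′ j↦a j′↦a+1 j≤p with m≤n⇒m<n∨m≡n (s≤s⁻¹ j≤p)
    ... | inj₁ j<p = top-order g s top≡ (<⇒≤ x<a) j j′ j↦a j′↦a+1 j<p
    ... | inj₂ j≡p with refl ← toℕ-injective j≡p = ⊥-elim (<-irrefl j↦a x<a)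

  position : ∀ {v} → v < n → ∃ λ j → val j ≡ v
  position v<n with j , j↦ ← Perm-surjective π (fromℕ< v<n) = j , trans (cong toℕ j↦) (toℕ-fromℕ< v<n)

  ¬Conflict⇒nested : ∀ {i j} → i <ᶠ j → ¬ Conflict π i j →
    val j < val i × (∀ z → val j ≤ val z → val z ≤ val i → toℕ i ≤ toℕ z × toℕ z ≤ toℕ j)
  ¬Conflict⇒nested {i} {j} i<j ¬c = descent , nested
    where
    descent : val j < val i
    descent with <-cmp (val j) (val i)
    ... | tri< j<i _ _ = j<i
    ... | tri≈ _ j≡i _ = ⊥-elim (<⇒≢ᶠ i<j (sym (val-injective j≡i)))
    ... | tri> _ _ i<j′ = ⊥-elim (¬c (ascent i<j′))
    nested : ∀ z → val j ≤ val z → val z ≤ val i → toℕ i ≤ toℕ z × toℕ z ≤ toℕ j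
    nested z j≤z z≤i with m≤n⇒m<n∨m≡n j≤z | m≤n⇒m<n∨m≡n z≤i
    ... | inj₂ j≡z | _ with refl ← val-injective j≡z = <⇒≤ i<j , ≤-refl
    ... | inj₁ _ | inj₂ z≡i with refl ← val-injective z≡i = ≤-refl , <⇒≤ i<j
    ... | inj₁ j<z | inj₁ z<i =
      ≮⇒≥ (λ z<i′ → ¬c (gap-before z j<z z<i z<i′)) , ≮⇒≥ (λ j<z′ → ¬c (gap-after z j<z z<i j<z′))

  -- Otherwise x + 1, lying between val p and val q, would be read between q and p.
  conflict-unread-successor : ∀ {q p} → q <ᶠ p → ¬ Read (toℕ p) (suc (val p)) → Conflict π q p
  conflict-unread-successor {q} {p} q<p ¬r with conflict? π q p
  ... | yes c = c
  ... | no ¬c with p<q , nested ← ¬Conflict⇒nested q<p ¬c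
              with z , z↦ ← position (≤-<-trans p<q (toℕ<n (fun π q)))
              with _ , z≤p ← nested z (subst (val p ≤_) (sym z↦) (n≤1+n _)) (subst (_≤ val q) (sym z↦) p<q)
              with m≤n⇒m<n∨m≡n z≤p
  ...   | inj₁ z<p = ⊥-elim (¬r (z , z<p , z↦))
  ...   | inj₂ z≡p = ⊥-elim (1+n≢n (trans (sym z↦) (cong val (toℕ-injective z≡p))))

  -- Of two stack tops above c, the later cannot go on the earlier: with t = a + 1 the earlier
  -- top, a would be read between them, contradicting top-order.
  conflict-stack-tops : ∀ {i C c s q q′ rest} → Greedy i C c →
    lookup (Config.stacks C) s ≡ val q ∷ rest → c < val q′ → q <ᶠ q′ → toℕ q′ < i → Conflict π q q′
  conflict-stack-tops {i} {C} {c} {s} {q} {q′} {rest} g top≡ c<t′ q<q′ q′<i with conflict? π q q′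
  ... | yes cf = cf
  ... | no ¬c with t′<t , nested ← ¬Conflict⇒nested q<q′ ¬c = ⊥-elim contradiction
    where
    a = pred (val q)
    a+1≡t : suc a ≡ val q
    a+1≡t = suc-pred (val q) {{>-nonZero (≤-<-trans z≤n t′<t)}}
    t′≤a : val q′ ≤ a
    t′≤a = s≤s⁻¹ (subst (val q′ <_) (sym a+1≡t) t′<t)
    contradiction : ⊥
    contradiction with z , z↦a ← position (<-trans (n<1+n a) (subst (_< n) (sym a+1≡t) (toℕ<n (fun π q))))
                  with q≤z , z≤q′ ← nested z (subst (val q′ ≤_) (sym z↦a) t′≤a)
                                             (subst (_≤ val q) (sym z↦a) (subst (a ≤_) a+1≡t (n≤1+n a)))
                  with m≤n⇒m<n∨m≡n q≤z
    ... | inj₂ q≡z = 1+n≢n (trans a+1≡t (trans (cong val (toℕ-injective q≡z)) z↦a))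
    ... | inj₁ q<z = <-asym q<z (top-order g s (trans top≡ (cong (_∷ rest) (sym a+1≡t))) (<⇒≤ (<-≤-trans c<t′ t′≤a))
                                  z q z↦a (sym a+1≡t) (≤-<-trans z≤q′ q′<i))

  -- The pivot is the position of c, the blockers are p and the positions of the stack tops.
  stuck⇒Obstruction : ∀ {inp sts out c} p → Greedy (toℕ p) (config (val p ∷ inp) sts out) c →
    ¬ Read (toℕ p) c → c < val p → ¬ Read (toℕ p) (suc (val p)) →
    (∀ s → ∃₂ λ t rest → lookup sts s ≡ t ∷ rest) → Obstruction k π
  stuck⇒Obstruction {inp} {sts} {out} {c} p g ¬rc c<x ¬rx+1 occupied =
    obstruction pc (tabulateⱽ blocker)
      (λ a → subst (_<ᶠ pc) (sym (lookup∘tabulate blocker a)) (blocker<pc a))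
      (λ a → subst (λ b → fun π pc <ᶠ fun π b) (sym (lookup∘tabulate blocker a)) (c<blocker a))
      (λ a b a≢b → subst₂ (Conflicting π) (sym (lookup∘tabulate blocker a)) (sym (lookup∘tabulate blocker b))
                           (conflicting a b a≢b))
    where
    top-read : ∀ s → Read (toℕ p) (proj₁ (occupied s))
    top-read s = held-read g s (subst (_ ∈_) (sym (proj₂ (proj₂ (occupied s)))) (here refl))
    top : Fin k → Fin n
    top s = proj₁ (top-read s)
    top<p : ∀ s → top s <ᶠ p
    top<p s = proj₁ (proj₂ (top-read s))
    top≡ : ∀ s → lookup sts s ≡ val (top s) ∷ proj₁ (proj₂ (occupied s))
    top≡ s = trans (proj₂ (proj₂ (occupied s))) (cong (_∷ _) (sym (proj₂ (proj₂ (top-read s)))))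
    top∈ : ∀ s → val (top s) ∈ lookup sts s
    top∈ s = subst (val (top s) ∈_) (sym (top≡ s)) (here refl)
    c<top : ∀ s → c < val (top s)
    c<top s with m≤n⇒m<n∨m≡n (held-≥ g s (top∈ s))
    ... | inj₁ c<t = c<t
    ... | inj₂ c≡t = ⊥-elim (¬rc (top s , top<p s , sym c≡t))
    pc-spec = position (<-trans c<x (toℕ<n (fun π p)))
    pc = proj₁ pc-spec
    pc↦c : val pc ≡ c
    pc↦c = proj₂ pc-spec
    p<pc : p <ᶠ pc
    p<pc with <-cmp (toℕ pc) (toℕ p)
    ... | tri< pc<p _ _ = ⊥-elim (¬rc (pc , pc<p , pc↦c))
    ... | tri≈ _ pc≡p _ = ⊥-elim (<-irrefl (trans (sym pc↦c) (cong val (toℕ-injective pc≡p))) c<x)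
    ... | tri> _ _ p<pc = p<pc
    blocker : Fin (suc k) → Fin n
    blocker zero    = p
    blocker (suc s) = top s
    blocker<pc : ∀ a → blocker a <ᶠ pc
    blocker<pc zero    = p<pc
    blocker<pc (suc s) = <-trans (top<p s) p<pc
    c<blocker : ∀ a → val pc < val (blocker a)
    c<blocker zero    = subst (_< val p) (sym pc↦c) c<x
    c<blocker (suc s) = subst (_< val (top s)) (sym pc↦c) (c<top s)
    conflicting : ∀ a b → a ≢ b → Conflicting π (blocker a) (blocker b)
    conflicting zero    zero    a≢b = ⊥-elim (a≢b refl)
    conflicting zero    (suc s) _   = inj₂ (top<p s , conflict-unread-successor (top<p s) ¬rx+1)
    conflicting (suc s) zero    _   = inj₁ (top<p s , conflict-unread-successor (top<p s) ¬rx+1)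
    conflicting (suc s) (suc s′) a≢b with <-cmp (toℕ (top s)) (toℕ (top s′))
    ... | tri< lt _ _ = inj₁ (lt , conflict-stack-tops g (top≡ s) (c<top s′) lt (top<p s′))
    ... | tri> _ _ gt = inj₂ (gt , conflict-stack-tops g (top≡ s′) (c<top s) gt (top<p s))
    ... | tri≈ _ eq _ = ⊥-elim (a≢b (cong suc (held-once g s s′ (top∈ s)
                          (subst (λ t → val t ∈ lookup sts s′) (sym (toℕ-injective eq)) (top∈ s′)))))

  next≤entry : ∀ {p inp sts out c} → Greedy (toℕ p) (config (val p ∷ inp) sts out) c → c ≤ val p
  next≤entry {p} g = ≮⇒≥ (¬Read-own p ∘ below-read g)

  greedy-step : ∀ p {inp sts out c} → Greedy (toℕ p) (config (val p ∷ inp) sts out) c → ¬ Read (toℕ p) c →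
                ¬ Obstruction k π → (∀ {C c′} → Greedy (suc (toℕ p)) C c′ → ¬ Read (suc (toℕ p)) c′ → Run C) →
                Run (config (val p ∷ inp) sts out)
  greedy-step p {sts = sts} {c = c} g ¬rc ¬O continue with c ≟ℕ val p
  ... | yes refl =
    let C′ , c′ , g′ , ¬r′ , steps = cascade n (m≤n+m n (suc c)) (Greedy-bypass p g)
    in  bypass ◅ (steps ◅◅ continue g′ ¬r′)
  ... | no c≢x with read? (toℕ p) (suc (val p)) | any? (λ s → ≡-dec _≟ℕ_ (lookup sts s) [])
  ...   | yes r | _ with s , x+1∈ ← read-held g r (≤-trans (next≤entry g) (n≤1+n _))
                    with lo , s≡ ← interval g s
                    with ∈-range-pred lo _ (subst (_ ∈_) s≡ x+1∈)
  ...     | inj₁ refl =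
    push s ◅ continue (Greedy-push p s _ (≤∧≢⇒< (next≤entry g) c≢x) s≡ only-s g) (¬Read-suc p ¬rc c≢x)
    where
    only-s : ∀ s′ → s′ ≢ s → ¬ suc (val p) ∈ lookup sts s′
    only-s s′ s′≢s x+1∈′ = s′≢s (held-once g s′ s x+1∈′ x+1∈)
  ...     | inj₂ (_ , refl , x∈) = ⊥-elim (¬Read-own p (held-read g s (subst (_ ∈_) (sym s≡) x∈)))
  greedy-step p {sts = sts} g ¬rc ¬O continue | no c≢x | no ¬r | yes (s , s≡[]) =
    push s ◅ continue (Greedy-push p s 0 (≤∧≢⇒< (next≤entry g) c≢x) s≡[] (λ s′ _ x+1∈ → ¬r (held-read g s′ x+1∈)) g)
                      (¬Read-suc p ¬rc c≢x)
  greedy-step p {sts = sts} g ¬rc ¬O continue | no c≢x | no ¬r | no all-occupied =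
    ⊥-elim (¬O (stuck⇒Obstruction p g ¬rc (≤∧≢⇒< (next≤entry g) c≢x) ¬r
                                  (λ s → ≢[]⇒∷ (λ s≡[] → all-occupied (s , s≡[])))))

  Greedy-final : ∀ {C c} → Greedy n C c → ¬ Read n c → C ≡ final
  Greedy-final {config inp sts out} {c} g ¬rc =
    finished (trans (unread g) (drop-tabulate-length val))
             (replicate-[] sts λ s → ∉⇒[] λ v∈ → <⇒≱ (Read⇒<n (held-read g s v∈)) (subst (_≤ _) c≡n (held-≥ g s v∈)))
             (trans (emitted g) (cong upTo c≡n))
    where
    finished : inp ≡ [] → sts ≡ replicate k [] → out ≡ upTo n → config inp sts out ≡ final
    finished refl refl refl = refl
    c≡n : c ≡ n
    c≡n with <-cmp c n
    ... | tri< c<n _ _ = ⊥-elim (¬rc (proj₁ (position c<n) , toℕ<n _ , proj₂ (position c<n)))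
    ... | tri≈ _ c≡n _ = c≡n
    ... | tri> _ _ n<c = ⊥-elim (<-irrefl refl (Read⇒<n (below-read g n<c)))

  greedy : ¬ Obstruction k π → ∀ r {i C c} → i + r ≡ n → Greedy i C c → ¬ Read i c → Run C
  greedy ¬O zero {i} i+0≡n g ¬rc =
    subst Run (sym (Greedy-final (subst (λ j → Greedy j _ _) i≡n g) (subst (λ j → ¬ Read j _) i≡n ¬rc))) ε
    where i≡n = trans (sym (+-identityʳ i)) i+0≡n
  greedy ¬O (suc r) {i} {config inp sts out} i+r≡n g ¬rc =
    subst Run (cong (λ l → config l sts out) (sym inp≡))
      (greedy-step p (subst (λ l → Greedy (toℕ p) (config l sts out) _) inp≡ gₚ)
                     (subst (λ j → ¬ Read j _) (sym p≡i) ¬rc) ¬O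
        (greedy ¬O r (trans (cong (λ j → suc j + r) p≡i) (trans (sym (+-suc i r)) i+r≡n))))
    where
    i<n : i < n
    i<n = subst (i <_) i+r≡n (subst (_≤ i + suc r) (+-comm i 1) (+-monoʳ-≤ i (s≤s z≤n)))
    p = fromℕ< i<n
    p≡i : toℕ p ≡ i
    p≡i = toℕ-fromℕ< i<n
    gₚ : Greedy (toℕ p) (config inp sts out) _
    gₚ = subst (λ j → Greedy j _ _) (sym p≡i) g
    inp≡ : inp ≡ val p ∷ drop (suc (toℕ p)) (word π)
    inp≡ = trans (unread gₚ) (drop-tabulate val p)

  ¬Obstruction⇒sortable : ¬ Obstruction k π → Run initial
  ¬Obstruction⇒sortable ¬O = greedy ¬O n refl Greedy-initial (λ ())

-- Small obstructions

length-concatMap-≤ : ∀ {A B : Set} (g : A → List B) b xs → (∀ x → length (g x) ≤ b) →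
                     length (concatMap g xs) ≤ length xs * b
length-concatMap-≤ g b []       g≤b = z≤n
length-concatMap-≤ g b (x ∷ xs) g≤b =
  subst (_≤ b + length xs * b) (sym (length-++ (g x))) (+-mono-≤ (g≤b x) (length-concatMap-≤ g b xs g≤b))

length-allFin : ∀ m → length (allFin m) ≡ m
length-allFin m = length-tabulate id

obstructionBound : ℕ → ℕ
obstructionBound k = suc (suc k + suc k * (suc k * 2))

module Support (k : ℕ) {n} {π : Perm n} (O : Obstruction k π) where
  open Obstruction O

  pairWitnesses : ∀ a b → Dec (a ≡ b) → List (Fin n)
  pairWitnesses a b (yes _)  = []
  pairWitnesses a b (no a≢b) = witnessesᶜ (conflict a b a≢b)

  rowWitnesses : Fin (suc k) → List (Fin n)
  rowWitnesses a = concatMap (λ b → pairWitnesses a b (a ≟ᶠ b)) (allFin (suc k))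

  allWitnesses : List (Fin n)
  allWitnesses = concatMap rowWitnesses (allFin (suc k))

  support : List (Fin n)
  support = pivot ∷ tabulate (lookup blockers) ++ allWitnesses

  length-support : length support ≤ obstructionBound k
  length-support = s≤s (begin
    length (tabulate (lookup blockers) ++ allWitnesses)
      ≡⟨ length-++ (tabulate (lookup blockers)) ⟩
    length (tabulate (lookup blockers)) + length allWitnesses
      ≤⟨ +-mono-≤ (≤-reflexive (length-tabulate (lookup blockers))) allWitnesses-≤ ⟩
    suc k + suc k * (suc k * 2) ∎)
    where
    open ≤-Reasoning
    pair-≤ : ∀ a b → length (pairWitnesses a b (a ≟ᶠ b)) ≤ 2
    pair-≤ a b with a ≟ᶠ b
    ... | yes _  = z≤n
    ... | no a≢b = length-witnessesᶜ (conflict a b a≢b)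
    row-≤ : ∀ a → length (rowWitnesses a) ≤ suc k * 2
    row-≤ a = subst (λ l → length (rowWitnesses a) ≤ l * 2) (length-allFin (suc k))
                    (length-concatMap-≤ (λ b → pairWitnesses a b (a ≟ᶠ b)) 2 (allFin (suc k)) (pair-≤ a))
    allWitnesses-≤ : length allWitnesses ≤ suc k * (suc k * 2)
    allWitnesses-≤ = subst (λ l → length allWitnesses ≤ l * (suc k * 2)) (length-allFin (suc k))
                           (length-concatMap-≤ rowWitnesses (suc k * 2) (allFin (suc k)) row-≤)

  pivot∈ : pivot ∈ support
  pivot∈ = here refl

  blocker∈ : ∀ a → lookup blockers a ∈ support
  blocker∈ a = there (∈-++⁺ˡ (∈-tabulate⁺ {f = lookup blockers} a))

  witness∈ : ∀ a b {z} → z ∈ pairWitnesses a b (a ≟ᶠ b) → z ∈ support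
  witness∈ a b z∈ = there (∈-++⁺ʳ (tabulate (lookup blockers))
    (∈-concatMap⁺ rowWitnesses (lose (∈-allFin a) (∈-concatMap⁺ (λ b → pairWitnesses a b (a ≟ᶠ b)) (lose (∈-allFin b) z∈)))))

Obstruction-small : ∀ k {n} (π : Perm n) → Obstruction k π →
  ∃ λ m → Σ (Perm m) λ σ → Contains π σ × m ≤ obstructionBound k × Obstruction k σ
Obstruction-small k π O
  with m , σ , f , f-emb , m≤ , covers ← pattern-covering π (Support.support k O) =
  m , σ , (f , f-emb) , ≤-trans m≤ (Support.length-support k O) ,
  obstruction c̃ (tabulateⱽ q̃) q̃<c̃ σc̃<σq̃ q̃-conflict
  where
  open Obstruction O
  open Support k O
  c̃ = proj₁ (covers pivot∈)
  q̃ : Fin (suc k) → Fin m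
  q̃ a = proj₁ (covers (blocker∈ a))
  q̃<c̃ : ∀ a → lookup (tabulateⱽ q̃) a <ᶠ c̃
  q̃<c̃ a rewrite lookup∘tabulate q̃ a = IsEmbedding-reflects-< {π = π} {σ} f f-emb (q̃ a) c̃
    (subst₂ _<ᶠ_ (sym (proj₂ (covers (blocker∈ a)))) (sym (proj₂ (covers pivot∈))) (before a))
  σc̃<σq̃ : ∀ a → fun σ c̃ <ᶠ fun σ (lookup (tabulateⱽ q̃) a)
  σc̃<σq̃ a rewrite lookup∘tabulate q̃ a = from (proj₂ f-emb c̃ (q̃ a))
    (subst₂ (λ u v → fun π u <ᶠ fun π v) (sym (proj₂ (covers pivot∈))) (sym (proj₂ (covers (blocker∈ a)))) (above a))
  pull : ∀ a b (d : Dec (a ≡ b)) → a ≢ b → (∀ {z} → z ∈ pairWitnesses a b d → z ∈ support) →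
         Conflicting σ (q̃ a) (q̃ b)
  pull a b (yes a≡b) a≢b _   = ⊥-elim (a≢b a≡b)
  pull a b (no a≢b)  _   sub = Conflicting-pull f f-emb (proj₂ (covers (blocker∈ a))) (proj₂ (covers (blocker∈ b)))
                                 (conflict a b a≢b) (covers ∘ sub)
  q̃-conflict : ∀ a b → a ≢ b → Conflicting σ (lookup (tabulateⱽ q̃) a) (lookup (tabulateⱽ q̃) b)
  q̃-conflict a b a≢b rewrite lookup∘tabulate q̃ a | lookup∘tabulate q̃ b =
    pull a b (a ≟ᶠ b) a≢b (witness∈ a b)

-- Enumerating the basis

allVecs : (l m : ℕ) → List (Vec (Fin m) l)
allVecs zero    m = [] ∷ []
allVecs (suc l) m = concatMap (λ x → map (x ∷_) (allVecs l m)) (allFin m)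

∈-allVecs : ∀ {l m} (v : Vec (Fin m) l) → v ∈ allVecs l m
∈-allVecs []                = here refl
∈-allVecs {suc l} {m} (x ∷ v) =
  ∈-concatMap⁺ (λ x → map (x ∷_) (allVecs l m)) (lose (∈-allFin x) (∈-map⁺ (x ∷_) (∈-allVecs v)))

∃-Vec? : ∀ {l m} {P : Vec (Fin m) l → Set} → (∀ v → Dec (P v)) → Dec (Σ (Vec (Fin m) l) P)
∃-Vec? {l} {m} P? = map′ satisfied (λ (v , p) → lose (∈-allVecs v) p) (anyᴸ? P? (allVecs l m))

injective? : ∀ {m} (f : Fin m → Fin m) → Dec (Injective _≡_ _≡_ f)
injective? f = map′ (λ h {x} {y} → h x y) (λ h x y → h)
                    (all? λ x → all? λ y → (f x ≟ᶠ f y) →-dec (x ≟ᶠ y))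

obstruction? : ∀ k {m} (σ : Perm m) → Dec (Obstruction k σ)
obstruction? k σ = map′ (λ (c , q , q<c , σc<σq , q-conf) → obstruction c q q<c σc<σq q-conf)
                        (λ (obstruction c q q<c σc<σq q-conf) → c , q , q<c , σc<σq , q-conf)
  (any? λ c → ∃-Vec? λ q →
     (all? λ a → lookup q a <? c) ×-dec (all? λ a → fun σ c <? fun σ (lookup q a)) ×-dec
     (all? λ a → all? λ b → ¬? (a ≟ᶠ b) →-dec conflicting? σ (lookup q a) (lookup q b)))

obstructedWithValues : ℕ → (m : ℕ) → Vec (Fin m) m → List AnyPerm
obstructedWithValues k m v with injective? (lookup v)
... | no _ = []
... | yes v-inj with obstruction? k (perm (lookup v) v-inj)
...   | no _  = []
...   | yes _ = (m , perm (lookup v) v-inj) ∷ []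

obstructedWithValues-sound : ∀ k m v {m′} {σ : Perm m′} → (m′ , σ) ∈ obstructedWithValues k m v → Obstruction k σ
obstructedWithValues-sound k m v σ∈ with injective? (lookup v)
obstructedWithValues-sound k m v () | no _
... | yes v-inj with obstruction? k (perm (lookup v) v-inj)
obstructedWithValues-sound k m v () | yes v-inj | no _
... | yes O with here refl ← σ∈ = O

obstructedWithValues-complete : ∀ k m (σ : Perm m) → Obstruction k σ →
  Σ (Perm m) λ σ′ → (m , σ′) ∈ obstructedWithValues k m (tabulateⱽ (fun σ)) × (∀ i → fun σ′ i ≡ fun σ i)
obstructedWithValues-complete k m σ O with injective? (lookup (tabulateⱽ (fun σ)))
... | no ¬inj = ⊥-elim (¬inj λ eq → inj σ (trans (sym (σ≗v _)) (trans eq (σ≗v _))))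
  where σ≗v = lookup∘tabulate (fun σ)
... | yes v-inj with obstruction? k (perm (lookup (tabulateⱽ (fun σ))) v-inj)
...   | yes _ = perm _ v-inj , here refl , lookup∘tabulate (fun σ)
...   | no ¬O = ⊥-elim (¬O (Obstruction-embed {π = σ′} {σ} id (IsEmbedding-id σ′ σ (sym ∘ lookup∘tabulate (fun σ))) O))
  where σ′ = perm (lookup (tabulateⱽ (fun σ))) v-inj

-- Up to extensional equality of permutations, all obstructed ones of length at most N.
obstructed : ℕ → ℕ → List AnyPerm
obstructed k N = concatMap (λ m → concatMap (obstructedWithValues k m) (allVecs m m)) (upTo (suc N))
obstructed-sound : ∀ k N {m} {σ : Perm m} → (m , σ) ∈ obstructed k N → Obstruction k σ
obstructed-sound k N σ∈
  with m′ , σ∈′ ← satisfied (∈-concatMap⁻ (λ m → concatMap (obstructedWithValues k m) (allVecs m m)) {xs = upTo (suc N)} σ∈)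
  with v , σ∈″ ← satisfied (∈-concatMap⁻ (obstructedWithValues k m′) {xs = allVecs m′ m′} σ∈′)
  = obstructedWithValues-sound k m′ v σ∈″

obstructed-complete : ∀ k N {m} (σ : Perm m) → m ≤ N → Obstruction k σ →
  Σ (Perm m) λ σ′ → (m , σ′) ∈ obstructed k N × (∀ i → fun σ′ i ≡ fun σ i)
obstructed-complete k N {m} σ m≤N O with σ′ , σ′∈ , σ′≗σ ← obstructedWithValues-complete k m σ O =
  σ′ ,
  ∈-concatMap⁺ (λ m → concatMap (obstructedWithValues k m) (allVecs m m))
    (lose (∈-upTo⁺ (s≤s m≤N)) (∈-concatMap⁺ (obstructedWithValues k m) (lose (∈-allVecs (tabulateⱽ (fun σ))) σ′∈))) ,
  σ′≗σ

sortable⇔¬Obstruction : ∀ k {n} (π : Perm n) → Sortable k π ⇔ (¬ Obstruction k π)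
sortable⇔¬Obstruction k π = mk⇔ (Device.sortable⇒¬Obstruction k π) (Device.¬Obstruction⇒sortable k π)

¬Obstruction⇔Av : ∀ k {n} (π : Perm n) → (¬ Obstruction k π) ⇔ Av (obstructed k (obstructionBound k)) π
¬Obstruction⇔Av k π = mk⇔ avoids obstruction-free
  where
  avoids : ¬ Obstruction k π → Av (obstructed k (obstructionBound k)) π
  avoids ¬O σ σ∈ (f , f-emb) = ¬O (Obstruction-embed f f-emb (obstructed-sound k (obstructionBound k) σ∈))
  obstruction-free : Av (obstructed k (obstructionBound k)) π → ¬ Obstruction k π
  obstruction-free av O =
    let m , σ , (f , f-emb) , m≤ , Oσ = Obstruction-small k π O
        σ′ , σ′∈ , σ′≗σ = obstructed-complete k (obstructionBound k) σ m≤ Oσ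
    in  av σ′ σ′∈ (f , IsEmbedding-∘ {π = π} {σ} {σ′} f id f-emb (IsEmbedding-id σ σ′ σ′≗σ))

mainTheorem14 : (k : ℕ) → 1 ≤ k →
    Σ (List AnyPerm) λ B →
    ∀ {n : ℕ} (π : Perm n) → Sortable k π ⇔ Av B π
mainTheorem14 k _ =
  obstructed k (obstructionBound k) ,
  λ π → ¬Obstruction⇔Av k π ⇔-∘ sortable⇔¬Obstruction k π
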